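{- For any valid $\mathcal{L}_{\mathrm{PA}}(\omega)$-sentence $\phi$ and any $i\in\omega$, there is a valid very $i$-stratified $\mathcal{L}_{\mathrm{PA}}(\mathcal{I})$-sentence $\psi$ such that $\psi^-$ is identical to $\phi$.
   Context: Base logic: first-order logic extended by unary operators $\Box$ (formulas $\Box\phi$, $\mathrm{FV}(\Box\phi)=\mathrm{FV}(\phi)$); a structure additionally assigns a truth value $\mathscr{M}\models\Box\phi[s]$ to each operator, formula and assignment, independent of $s(x)$ for $x\notin\mathrm{FV}(\phi)$, invariant under alphabetic variants, and respecting variable substitution; a formula is valid if true in every structure under every assignment. $\mathcal{L}_{\mathrm{PA}}(\omega)$ is the language of arithmetic plus operators $\Box_i$ ($i\in\omega$). $\mathcal{I}=((\epsilon_0\cdot\omega)\times\omega)\sqcup\omega$; $\mathcal{L}_{\mathrm{PA}}(\mathcal{I})$ additionally has operators $\Box^\alpha_i$ ($\alpha<\epsilon_0\cdot\omega$, $i\in\omega$); $\mathrm{On}(\phi)$ is the set of superscripts in $\phi$. $i$-stratified formulas: atomic ones; $\neg,\rightarrow,\forall$ combinations of $i$-stratified ones; $\Box_j\phi_0$ ($j\ne i$) iff it has no superscripted operators; never $\Box^\alpha_j\phi_0$ ($j\ne i$) or $\Box_i\phi_0$; $\Box^\alpha_i\phi_0$ iff $\phi_0$ is $i$-stratified and $\alpha$ exceeds every element of $\mathrm{On}(\phi_0)$. Very $i$-stratified: $i$-stratified with $\mathrm{On}(\phi)\subseteq\{\epsilon_0\cdot1,\epsilon_0\cdot2,\ldots\}$.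 $\phi^-$ erases all superscripts from $\phi$. -}

module Defs where

open import Level using (0ℓ)
open import Data.Nat using (ℕ; _<_; _≤_; _≟_)
open import Data.Bool using (Bool; if_then_else_)
open import Data.Product using (Σ; _×_; _,_; proj₁; proj₂)
open import Data.Sum using (_⊎_; inj₁; inj₂)
open import Data.Unit using (⊤)
open import Data.Empty using (⊥)
open import Data.List using (List; []; _∷_)
open import Relation.Nullary using (¬_)
open import Relation.Nullary.Decidable using (⌊_⌋)
open import Relation.Binary.PropositionalEquality using (_≡_; _≢_)
open import Axiom.ExcludedMiddle using (ExcludedMiddle)

Var : Set
Var = ℕ

data Term : Set where
  var  : Var → Term
  zer  : Term
  suc′ : Term → Term
  _⊕_  : Term → Term → Term
  _⊗_  : Term → Term → Term

data Formula (Op : Set) : Set where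
  _≐_  : Term → Term → Formula Op
  neg  : Formula Op → Formula Op
  _⇒_  : Formula Op → Formula Op → Formula Op
  all  : Var → Formula Op → Formula Op
  box  : Op → Formula Op → Formula Op

module _ {Op : Set} where

  _∈FVt_ : Var → Term → Set
  x ∈FVt var y = x ≡ y
  x ∈FVt zer = ⊥
  x ∈FVt suc′ t = x ∈FVt t
  x ∈FVt (t ⊕ u) = x ∈FVt t ⊎ x ∈FVt u
  x ∈FVt (t ⊗ u) = x ∈FVt t ⊎ x ∈FVt u

  _∈FV_ : Var → Formula Op → Set
  x ∈FV (t ≐ u) = x ∈FVt t ⊎ x ∈FVt u
  x ∈FV neg φ = x ∈FV φ
  x ∈FV (φ ⇒ ψ) = x ∈FV φ ⊎ x ∈FV ψ
  x ∈FV all y φ = x ≢ y × x ∈FV φ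
  x ∈FV box o φ = x ∈FV φ

  Sentence : Formula Op → Set
  Sentence φ = ∀ x → ¬ (x ∈FV φ)

  subt : Var → Var → Term → Term
  subt x y (var z) = if ⌊ z ≟ x ⌋ then var y else var z
  subt x y zer = zer
  subt x y (suc′ t) = suc′ (subt x y t)
  subt x y (t ⊕ u) = subt x y t ⊕ subt x y u
  subt x y (t ⊗ u) = subt x y t ⊗ subt x y u

  _[_/_] : Formula Op → Var → Var → Formula Op
  (t ≐ u) [ y / x ] = subt x y t ≐ subt x y u
  neg φ [ y / x ] = neg (φ [ y / x ])
  (φ ⇒ ψ) [ y / x ] = (φ [ y / x ]) ⇒ (ψ [ y / x ])
  all z φ [ y / x ] = if ⌊ z ≟ x ⌋ then all z φ else all z (φ [ y / x ])
  box o φ [ y / x ] = box o (φ [ y / x ])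

  FreeFor : Var → Var → Formula Op → Set
  FreeFor y x (t ≐ u) = ⊤
  FreeFor y x (neg φ) = FreeFor y x φ
  FreeFor y x (φ ⇒ ψ) = FreeFor y x φ × FreeFor y x ψ
  FreeFor y x (all z φ) = ¬ (x ∈FV all z φ) ⊎ (z ≢ y × FreeFor y x φ)
  FreeFor y x (box o φ) = FreeFor y x φ

  varα : List (Var × Var) → Var → Var → Set
  varα [] x y = x ≡ y
  varα ((a , b) ∷ Γ) x y = (x ≡ a × y ≡ b) ⊎ (x ≢ a × y ≢ b × varα Γ x y)

  termα : List (Var × Var) → Term → Term → Set
  termα Γ (var x) (var y) = varα Γ x y
  termα Γ zer zer = ⊤
  termα Γ (suc′ t) (suc′ t′) = termα Γ t t′
  termα Γ (t ⊕ u) (t′ ⊕ u′) = termα Γ t t′ × termα Γ u u′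
  termα Γ (t ⊗ u) (t′ ⊗ u′) = termα Γ t t′ × termα Γ u u′
  termα Γ _ _ = ⊥

  formα : List (Var × Var) → Formula Op → Formula Op → Set
  formα Γ (t ≐ u) (t′ ≐ u′) = termα Γ t t′ × termα Γ u u′
  formα Γ (neg φ) (neg φ′) = formα Γ φ φ′
  formα Γ (φ ⇒ ψ) (φ′ ⇒ ψ′) = formα Γ φ φ′ × formα Γ ψ ψ′
  formα Γ (all x φ) (all y φ′) = formα ((x , y) ∷ Γ) φ φ′
  formα Γ (box o φ) (box o′ φ′) = o ≡ o′ × formα Γ φ φ′
  formα Γ _ _ = ⊥

  _≈α_ : Formula Op → Formula Op → Set
  φ ≈α ψ = formα [] φ ψ

_[_↦_] : {D : Set} → (Var → D) → Var → D → (Var → D)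
(s [ x ↦ d ]) z = if ⌊ z ≟ x ⌋ then d else s z

record Structure (Op : Set) : Set₁ where
  field
    D   : Set
    z   : D
    sc  : D → D
    pl  : D → D → D
    tm  : D → D → D
    box⊨   : Op → Formula Op → (Var → D) → Bool
    box-fv : ∀ o φ (s s′ : Var → D) → (∀ x → x ∈FV φ → s x ≡ s′ x) →
             box⊨ o φ s ≡ box⊨ o φ s′
    box-α  : ∀ o φ φ′ (s : Var → D) → φ ≈α φ′ → box⊨ o φ s ≡ box⊨ o φ′ s
    box-sub : ∀ o φ x y (s : Var → D) → FreeFor y x φ →
              box⊨ o (φ [ y / x ]) s ≡ box⊨ o φ (s [ x ↦ s y ])

module _ {Op : Set} (M : Structure Op) where
  open Structure M
  open import Data.Bool using (T)

  ⟦_⟧ : Term → (Var → D) → D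
  ⟦ var x ⟧ s = s x
  ⟦ zer ⟧ s = z
  ⟦ suc′ t ⟧ s = sc (⟦ t ⟧ s)
  ⟦ t ⊕ u ⟧ s = pl (⟦ t ⟧ s) (⟦ u ⟧ s)
  ⟦ t ⊗ u ⟧ s = tm (⟦ t ⟧ s) (⟦ u ⟧ s)

  _⊨_[_] : Formula Op → (Var → D) → Set
  _⊨_[_] (t ≐ u) s = ⟦ t ⟧ s ≡ ⟦ u ⟧ s
  _⊨_[_] (neg φ) s = ¬ (_⊨_[_] φ s)
  _⊨_[_] (φ ⇒ ψ) s = _⊨_[_] φ s → _⊨_[_] ψ s
  _⊨_[_] (all x φ) s = ∀ d → _⊨_[_] φ (s [ x ↦ d ])
  _⊨_[_] (box o φ) s = T (box⊨ o φ s)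

-- Validity: true in every structure under every assignment.  The
-- metatheory is classical, so excluded middle is assumed.
Valid : {Op : Set} → Formula Op → Set₁
Valid {Op} φ = ExcludedMiddle 0ℓ → (M : Structure Op) (s : Var → Structure.D M) → _⊨_[_] M φ s

data Cnf : Set where
  𝟎    : Cnf
  ω^_+_ : Cnf → Cnf → Cnf

data _<c_ : Cnf → Cnf → Set where
  <𝟎 : ∀ {a b} → 𝟎 <c (ω^ a + b)
  <e : ∀ {a b a′ b′} → a <c a′ → (ω^ a + b) <c (ω^ a′ + b′)
  <r : ∀ {a b b′} → b <c b′ → (ω^ a + b) <c (ω^ a + b′)

-- well-formed (exponents non-increasing) CNF terms: exactly the ordinals < ε₀
IsCnf : Cnf → Set
IsCnf 𝟎 = ⊤
IsCnf (ω^ a + 𝟎) = IsCnf a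
IsCnf (ω^ a + (ω^ a′ + b)) = IsCnf a × IsCnf (ω^ a′ + b) × (a′ <c a ⊎ a′ ≡ a)

-- an ordinal ε₀·n + β  (n ∈ ℕ, β < ε₀), i.e. an element of ε₀·ω
record Ord : Set where
  constructor ε₀·_+_∣_
  field
    mult : ℕ
    rest : Cnf
    wf   : IsCnf rest
open Ord public

_<O_ : Ord → Ord → Set
α <O β = mult α < mult β ⊎ (mult α ≡ mult β × rest α <c rest β)

IsPosMultOfε₀ : Ord → Set
IsPosMultOfε₀ α = 1 ≤ mult α × rest α ≡ 𝟎

-- 𝓘 = ((ε₀·ω) × ω) ⊔ ω :  inj₁ (α , i) is □^α_i,  inj₂ i is □_i
𝓘 : Set
𝓘 = (Ord × ℕ) ⊎ ℕ

FormulaPAω : Set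
FormulaPAω = Formula ℕ

FormulaPA𝓘 : Set
FormulaPA𝓘 = Formula 𝓘

_∈On_ : Ord → FormulaPA𝓘 → Set
γ ∈On (t ≐ u) = ⊥
γ ∈On neg φ = γ ∈On φ
γ ∈On (φ ⇒ ψ) = γ ∈On φ ⊎ γ ∈On ψ
γ ∈On all x φ = γ ∈On φ
γ ∈On box (inj₁ (α , j)) φ = γ ≡ α ⊎ γ ∈On φ
γ ∈On box (inj₂ j) φ = γ ∈On φ

NoSuperscripts : FormulaPA𝓘 → Set
NoSuperscripts φ = ∀ γ → ¬ (γ ∈On φ)

Stratified : ℕ → FormulaPA𝓘 → Set
Stratified i (t ≐ u) = ⊤
Stratified i (neg φ) = Stratified i φ
Stratified i (φ ⇒ ψ) = Stratified i φ × Stratified i ψ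
Stratified i (all x φ) = Stratified i φ
Stratified i (box (inj₂ j) φ) = j ≢ i × NoSuperscripts φ
Stratified i (box (inj₁ (α , j)) φ) =
  j ≡ i × Stratified i φ × (∀ γ → γ ∈On φ → γ <O α)

VeryStratified : ℕ → FormulaPA𝓘 → Set
VeryStratified i φ = Stratified i φ × (∀ γ → γ ∈On φ → IsPosMultOfε₀ γ)

eraseOp : 𝓘 → ℕ
eraseOp (inj₁ (α , i)) = i
eraseOp (inj₂ i) = i

_⁻ : FormulaPA𝓘 → FormulaPAω
(t ≐ u) ⁻ = t ≐ u
neg φ ⁻ = neg (φ ⁻)
(φ ⇒ ψ) ⁻ = (φ ⁻) ⇒ (ψ ⁻)
all x φ ⁻ = all x (φ ⁻)
box o φ ⁻ = box (eraseOp o) (φ ⁻)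

-- Replace each □ᵢ by □ᵢ^(ε₀·(d+1)), where d is the □ᵢ-nesting depth of its scope, and leave
-- every other operator, together with its whole scope, without superscripts.  Superscripts then
-- grow strictly outwards and are positive multiples of ε₀, and erasing them gives back φ.
-- Validity transfers along the translation: an L(𝓘)-structure M induces an L(ω)-structure that
-- interprets □ⱼφ as M interprets the translated box.  Because the translation commutes with free
-- variables, alphabetic variants and substitution, this is a legitimate structure, and in it a
-- formula holds exactly when its translation holds in M.
module Submission where

open import Defs
open import Data.Nat using (ℕ; suc; _⊔_; _<_; _≟_; z≤n; s≤s)
open import Data.Nat.Properties using (m≤m⊔n; m≤n⊔m; <-≤-trans; n<1+n; m<n⇒m<1+n)
open import Data.Product using (Σ; ∃-syntax; _×_; _,_)
import Data.Product as Product
import Data.Sum as Sum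
open import Data.Sum using (inj₁; inj₂)
open import Data.Unit using (tt)
open import Data.Bool using (true; false)
open import Data.Empty using (⊥-elim)
open import Data.List using (List; _∷_)
open import Function using (_∘_)
open import Function.Bundles using (_⇔_; mk⇔; Equivalence)
open import Relation.Nullary using (yes; no)
open import Relation.Nullary.Decidable using (⌊_⌋)
open import Relation.Binary.PropositionalEquality
  using (_≡_; refl; trans; cong; cong₂; module ≡-Reasoning)

_⊆FV_ : {A B : Set} → Formula B → Formula A → Set
ψ ⊆FV φ = ∀ {x} → x ∈FV ψ → x ∈FV φ

data AlphaStep {Op : Set} (Γ : List (Var × Var)) : Formula Op → Formula Op → Set where
  ≐-step   : ∀ {t u t′ u′} → termα {Op} Γ t t′ → termα {Op} Γ u u′ →
             AlphaStep Γ (t ≐ u) (t′ ≐ u′)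
  neg-step : ∀ {φ φ′} → formα Γ φ φ′ → AlphaStep Γ (neg φ) (neg φ′)
  ⇒-step   : ∀ {φ ψ φ′ ψ′} → formα Γ φ φ′ → formα Γ ψ ψ′ → AlphaStep Γ (φ ⇒ ψ) (φ′ ⇒ ψ′)
  all-step : ∀ {x y φ φ′} → formα ((x , y) ∷ Γ) φ φ′ → AlphaStep Γ (all x φ) (all y φ′)
  box-step : ∀ {o φ φ′} → formα Γ φ φ′ → AlphaStep Γ (box o φ) (box o φ′)

formα⇒AlphaStep : ∀ {Op Γ} (φ φ′ : Formula Op) → formα Γ φ φ′ → AlphaStep Γ φ φ′
formα⇒AlphaStep (t ≐ u) (t′ ≐ u′) (p , q) = ≐-step p q
formα⇒AlphaStep (neg φ) (neg φ′) p = neg-step p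
formα⇒AlphaStep (φ ⇒ ψ) (φ′ ⇒ ψ′) (p , q) = ⇒-step p q
formα⇒AlphaStep (all x φ) (all y φ′) p = all-step p
formα⇒AlphaStep (box o φ) (box .o φ′) (refl , p) = box-step p
formα⇒AlphaStep (_ ≐ _) (neg _) ()
formα⇒AlphaStep (_ ≐ _) (_ ⇒ _) ()
formα⇒AlphaStep (_ ≐ _) (all _ _) ()
formα⇒AlphaStep (_ ≐ _) (box _ _) ()
formα⇒AlphaStep (neg _) (_ ≐ _) ()
formα⇒AlphaStep (neg _) (_ ⇒ _) ()
formα⇒AlphaStep (neg _) (all _ _) ()
formα⇒AlphaStep (neg _) (box _ _) ()
formα⇒AlphaStep (_ ⇒ _) (_ ≐ _) ()
formα⇒AlphaStep (_ ⇒ _) (neg _) ()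
formα⇒AlphaStep (_ ⇒ _) (all _ _) ()
formα⇒AlphaStep (_ ⇒ _) (box _ _) ()
formα⇒AlphaStep (all _ _) (_ ≐ _) ()
formα⇒AlphaStep (all _ _) (neg _) ()
formα⇒AlphaStep (all _ _) (_ ⇒ _) ()
formα⇒AlphaStep (all _ _) (box _ _) ()
formα⇒AlphaStep (box _ _) (_ ≐ _) ()
formα⇒AlphaStep (box _ _) (neg _) ()
formα⇒AlphaStep (box _ _) (_ ⇒ _) ()
formα⇒AlphaStep (box _ _) (all _ _) ()

-- body o φ ψ is the scope of the translated □ₒφ, given the translation ψ of φ.
record Compatible {A B : Set} (op : A → Formula A → B)
                  (body : A → Formula A → Formula B → Formula B) : Set where
  field
    body-FV      : ∀ o φ ψ → ψ ⊆FV φ → body o φ ψ ⊆FV φ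
    body-FreeFor : ∀ o φ ψ {x y} → FreeFor y x φ → FreeFor y x ψ → FreeFor y x (body o φ ψ)
    op-α         : ∀ o {Γ} φ φ′ → formα Γ φ φ′ → op o φ ≡ op o φ′
    body-α       : ∀ o {Γ} φ φ′ ψ ψ′ → formα Γ φ φ′ → formα Γ ψ ψ′ →
                   formα Γ (body o φ ψ) (body o φ′ ψ′)
    op-subst     : ∀ o φ x y → op o (φ [ y / x ]) ≡ op o φ
    body-subst   : ∀ o φ ψ x y → body o (φ [ y / x ]) (ψ [ y / x ]) ≡ body o φ ψ [ y / x ]

module Translation {A B : Set} {op : A → Formula A → B}
                   {body : A → Formula A → Formula B → Formula B}
                   (compatible : Compatible op body) where
  open Compatible compatible

  translate : Formula A → Formula B
  scope : A → Formula A → Formula B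

  translate (t ≐ u) = t ≐ u
  translate (neg φ) = neg (translate φ)
  translate (φ ⇒ ψ) = translate φ ⇒ translate ψ
  translate (all x φ) = all x (translate φ)
  translate (box o φ) = box (op o φ) (scope o φ)

  scope o φ = body o φ (translate φ)

  translate-FV : ∀ φ → translate φ ⊆FV φ
  translate-FV (t ≐ u) = λ p → p
  translate-FV (neg φ) = translate-FV φ
  translate-FV (φ ⇒ ψ) = Sum.map (translate-FV φ) (translate-FV ψ)
  translate-FV (all y φ) = Product.map₂ (translate-FV φ)
  translate-FV (box o φ) = body-FV o φ (translate φ) (translate-FV φ)

  translate-sentence : ∀ φ → Sentence φ → Sentence (translate φ)
  translate-sentence φ closed x = closed x ∘ translate-FV φ

  translate-FreeFor : ∀ {x y} φ → FreeFor y x φ → FreeFor y x (translate φ)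
  translate-FreeFor (t ≐ u) _ = tt
  translate-FreeFor (neg φ) = translate-FreeFor φ
  translate-FreeFor (φ ⇒ ψ) = Product.map (translate-FreeFor φ) (translate-FreeFor ψ)
  translate-FreeFor (all z φ) =
    Sum.map (λ x∉ → x∉ ∘ Product.map₂ (translate-FV φ)) (Product.map₂ (translate-FreeFor φ))
  translate-FreeFor (box o φ) p = body-FreeFor o φ (translate φ) p (translate-FreeFor φ p)

  translate-α : ∀ {Γ} φ φ′ → formα Γ φ φ′ → formα Γ (translate φ) (translate φ′)
  scope-α : ∀ o {Γ} φ φ′ → formα Γ φ φ′ → formα Γ (scope o φ) (scope o φ′)

  translate-α φ φ′ p with formα⇒AlphaStep φ φ′ p
  ... | ≐-step q r = q , r
  translate-α (neg φ) (neg φ′) _ | neg-step q = translate-α φ φ′ q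
  translate-α (φ ⇒ ψ) (φ′ ⇒ ψ′) _ | ⇒-step q r = translate-α φ φ′ q , translate-α ψ ψ′ r
  translate-α (all x φ) (all y φ′) _ | all-step q = translate-α φ φ′ q
  translate-α (box o φ) (box o φ′) _ | box-step q = op-α o φ φ′ q , scope-α o φ φ′ q

  scope-α o φ φ′ p = body-α o φ φ′ (translate φ) (translate φ′) p (translate-α φ φ′ p)

  translate-subst : ∀ φ x y → translate (φ [ y / x ]) ≡ translate φ [ y / x ]
  scope-subst : ∀ o φ x y → scope o (φ [ y / x ]) ≡ scope o φ [ y / x ]

  translate-subst (t ≐ u) x y = refl
  translate-subst (neg φ) x y = cong neg (translate-subst φ x y)
  translate-subst (φ ⇒ ψ) x y = cong₂ _⇒_ (translate-subst φ x y) (translate-subst ψ x y)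
  translate-subst (all z φ) x y with ⌊ z ≟ x ⌋
  ... | true = refl
  ... | false = cong (all z) (translate-subst φ x y)
  translate-subst (box o φ) x y = cong₂ box (op-subst o φ x y) (scope-subst o φ x y)

  scope-subst o φ x y = begin
    body o (φ [ y / x ]) (translate (φ [ y / x ]))  ≡⟨ cong (body o _) (translate-subst φ x y) ⟩
    body o (φ [ y / x ]) (translate φ [ y / x ])    ≡⟨ body-subst o φ (translate φ) x y ⟩
    body o φ (translate φ) [ y / x ]                ∎
    where open ≡-Reasoning

  pullback : Structure B → Structure A
  pullback M = record
    { D = D ; z = z ; sc = sc ; pl = pl ; tm = tm
    ; box⊨ = λ o φ → box⊨ (op o φ) (scope o φ)
    ; box-fv = λ o φ s s′ agree →
        box-fv (op o φ) (scope o φ) s s′ (λ x → agree x ∘ translate-FV (box o φ))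
    ; box-α = λ o φ φ′ s p →
        trans (cong (λ o′ → box⊨ o′ (scope o φ) s) (op-α o φ φ′ p))
              (box-α (op o φ′) (scope o φ) (scope o φ′) s (scope-α o φ φ′ p))
    ; box-sub = λ o φ x y s free →
        trans (cong₂ (λ o′ ψ → box⊨ o′ ψ s) (op-subst o φ x y) (scope-subst o φ x y))
              (box-sub (op o φ) (scope o φ) x y s (translate-FreeFor (box o φ) free))
    }
    where open Structure M

  module _ (M : Structure B) where

    ⟦⟧-pullback : ∀ t s → ⟦_⟧ (pullback M) t s ≡ ⟦_⟧ M t s
    ⟦⟧-pullback (var x) s = refl
    ⟦⟧-pullback zer s = refl
    ⟦⟧-pullback (suc′ t) s = cong (Structure.sc M) (⟦⟧-pullback t s)
    ⟦⟧-pullback (t ⊕ u) s = cong₂ (Structure.pl M) (⟦⟧-pullback t s) (⟦⟧-pullback u s)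
    ⟦⟧-pullback (t ⊗ u) s = cong₂ (Structure.tm M) (⟦⟧-pullback t s) (⟦⟧-pullback u s)

    translate-⊨ : ∀ φ s → _⊨_[_] (pullback M) φ s ⇔ _⊨_[_] M (translate φ) s
    translate-⊨ (t ≐ u) s rewrite ⟦⟧-pullback t s | ⟦⟧-pullback u s = mk⇔ (λ p → p) (λ p → p)
    translate-⊨ (neg φ) s = mk⇔ (λ ¬p → ¬p ∘ from) (λ ¬p → ¬p ∘ to)
      where open Equivalence (translate-⊨ φ s)
    translate-⊨ (φ ⇒ ψ) s =
      mk⇔ (λ f → to ψ⇔ ∘ f ∘ from φ⇔) (λ f → from ψ⇔ ∘ f ∘ to φ⇔)
      where open Equivalence
            φ⇔ = translate-⊨ φ s
            ψ⇔ = translate-⊨ ψ s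
    translate-⊨ (all x φ) s =
      mk⇔ (λ f d → to (translate-⊨ φ _) (f d)) (λ f d → from (translate-⊨ φ _) (f d))
      where open Equivalence
    translate-⊨ (box o φ) s = mk⇔ (λ p → p) (λ p → p)

  translate-valid : ∀ φ → Valid φ → Valid (translate φ)
  translate-valid φ valid lem M s =
    Equivalence.to (translate-⊨ M φ s) (valid lem (pullback M) s)

mapOp-compatible : {A B : Set} (f : A → B) → Compatible (λ o _ → f o) (λ _ _ ψ → ψ)
mapOp-compatible f = record
  { body-FV = λ _ _ _ p → p
  ; body-FreeFor = λ _ _ _ _ p → p
  ; op-α = λ _ _ _ _ → refl
  ; body-α = λ _ _ _ _ _ _ p → p
  ; op-subst = λ _ _ _ _ → refl
  ; body-subst = λ _ _ _ _ _ → refl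
  }

module Embedding = Translation (mapOp-compatible {ℕ} {𝓘} inj₂)

embed : FormulaPAω → FormulaPA𝓘
embed = Embedding.translate

embed-noSuperscripts : ∀ φ → NoSuperscripts (embed φ)
embed-noSuperscripts (t ≐ u) γ ()
embed-noSuperscripts (neg φ) = embed-noSuperscripts φ
embed-noSuperscripts (φ ⇒ ψ) γ = Sum.[ embed-noSuperscripts φ γ , embed-noSuperscripts ψ γ ]
embed-noSuperscripts (all x φ) = embed-noSuperscripts φ
embed-noSuperscripts (box j φ) = embed-noSuperscripts φ

embed⁻ : ∀ φ → embed φ ⁻ ≡ φ
embed⁻ (t ≐ u) = refl
embed⁻ (neg φ) = cong neg (embed⁻ φ)
embed⁻ (φ ⇒ ψ) = cong₂ _⇒_ (embed⁻ φ) (embed⁻ ψ)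
embed⁻ (all x φ) = cong (all x) (embed⁻ φ)
embed⁻ (box j φ) = cong (box j) (embed⁻ φ)

ε₀-mult : ℕ → Ord
ε₀-mult n = ε₀· suc n + 𝟎 ∣ tt

ε₀-mult-isPosMultOfε₀ : ∀ n → IsPosMultOfε₀ (ε₀-mult n)
ε₀-mult-isPosMultOfε₀ n = s≤s z≤n , refl

ε₀-mult-mono : ∀ {m n} → m < n → ε₀-mult m <O ε₀-mult n
ε₀-mult-mono m<n = inj₁ (s≤s m<n)

module Stratification (i : ℕ) where

  depth : FormulaPAω → ℕ
  depth (t ≐ u) = 0
  depth (neg φ) = depth φ
  depth (φ ⇒ ψ) = depth φ ⊔ depth ψ
  depth (all x φ) = depth φ
  depth (box j φ) with j ≟ i
  ... | yes _ = suc (depth φ)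
  ... | no _ = 0

  depth-α : ∀ {Γ} φ φ′ → formα Γ φ φ′ → depth φ ≡ depth φ′
  depth-α φ φ′ p with formα⇒AlphaStep φ φ′ p
  ... | ≐-step _ _ = refl
  depth-α (neg φ) (neg φ′) _ | neg-step q = depth-α φ φ′ q
  depth-α (φ ⇒ ψ) (φ′ ⇒ ψ′) _ | ⇒-step q r = cong₂ _⊔_ (depth-α φ φ′ q) (depth-α ψ ψ′ r)
  depth-α (all x φ) (all y φ′) _ | all-step q = depth-α φ φ′ q
  depth-α (box j φ) (box j φ′) p | box-step q with j ≟ i
  ... | yes _ = cong suc (depth-α φ φ′ q)
  ... | no _ = refl

  depth-subst : ∀ φ x y → depth (φ [ y / x ]) ≡ depth φ
  depth-subst (t ≐ u) x y = refl
  depth-subst (neg φ) x y = depth-subst φ x y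
  depth-subst (φ ⇒ ψ) x y = cong₂ _⊔_ (depth-subst φ x y) (depth-subst ψ x y)
  depth-subst (all z φ) x y with ⌊ z ≟ x ⌋
  ... | true = refl
  ... | false = depth-subst φ x y
  depth-subst (box j φ) x y with j ≟ i
  ... | yes _ = cong suc (depth-subst φ x y)
  ... | no _ = refl

  stratifyOp : ℕ → FormulaPAω → 𝓘
  stratifyOp j φ with j ≟ i
  ... | yes _ = inj₁ (ε₀-mult (depth φ) , i)
  ... | no _ = inj₂ j

  stratifyBody : ℕ → FormulaPAω → FormulaPA𝓘 → FormulaPA𝓘
  stratifyBody j φ ψ with j ≟ i
  ... | yes _ = ψ
  ... | no _ = embed φ

  stratify-compatible : Compatible stratifyOp stratifyBody
  stratify-compatible = record
    { body-FV = body-FV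
    ; body-FreeFor = body-FreeFor
    ; op-α = op-α
    ; body-α = body-α
    ; op-subst = op-subst
    ; body-subst = body-subst
    }
    where
    body-FV : ∀ j φ ψ → ψ ⊆FV φ → stratifyBody j φ ψ ⊆FV φ
    body-FV j φ ψ ψ⊆φ with j ≟ i
    ... | yes _ = ψ⊆φ
    ... | no _ = Embedding.translate-FV φ

    body-FreeFor : ∀ j φ ψ {x y} → FreeFor y x φ → FreeFor y x ψ →
                   FreeFor y x (stratifyBody j φ ψ)
    body-FreeFor j φ ψ p q with j ≟ i
    ... | yes _ = q
    ... | no _ = Embedding.translate-FreeFor φ p

    op-α : ∀ j {Γ} φ φ′ → formα Γ φ φ′ → stratifyOp j φ ≡ stratifyOp j φ′
    op-α j φ φ′ p with j ≟ i
    ... | yes _ = cong (λ n → inj₁ (ε₀-mult n , i)) (depth-α φ φ′ p)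
    ... | no _ = refl

    body-α : ∀ j {Γ} φ φ′ ψ ψ′ → formα Γ φ φ′ → formα Γ ψ ψ′ →
             formα Γ (stratifyBody j φ ψ) (stratifyBody j φ′ ψ′)
    body-α j φ φ′ ψ ψ′ p q with j ≟ i
    ... | yes _ = q
    ... | no _ = Embedding.translate-α φ φ′ p

    op-subst : ∀ j φ x y → stratifyOp j (φ [ y / x ]) ≡ stratifyOp j φ
    op-subst j φ x y with j ≟ i
    ... | yes _ = cong (λ n → inj₁ (ε₀-mult n , i)) (depth-subst φ x y)
    ... | no _ = refl

    body-subst : ∀ j φ ψ x y →
                 stratifyBody j (φ [ y / x ]) (ψ [ y / x ]) ≡ stratifyBody j φ ψ [ y / x ]
    body-subst j φ ψ x y with j ≟ i
    ... | yes _ = refl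
    ... | no _ = Embedding.translate-subst φ x y

  open Translation stratify-compatible public
    using () renaming (translate to stratify; translate-sentence to stratify-sentence;
                       translate-valid to stratify-valid)

  stratify⁻ : ∀ φ → stratify φ ⁻ ≡ φ
  stratify⁻ (t ≐ u) = refl
  stratify⁻ (neg φ) = cong neg (stratify⁻ φ)
  stratify⁻ (φ ⇒ ψ) = cong₂ _⇒_ (stratify⁻ φ) (stratify⁻ ψ)
  stratify⁻ (all x φ) = cong (all x) (stratify⁻ φ)
  stratify⁻ (box j φ) with j ≟ i
  ... | yes refl = cong (box j) (stratify⁻ φ)
  ... | no _ = cong (box j) (embed⁻ φ)

  stratify-superscripts : ∀ φ {γ} → γ ∈On stratify φ → ∃[ k ] k < depth φ × γ ≡ ε₀-mult k
  stratify-superscripts (t ≐ u) ()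
  stratify-superscripts (neg φ) = stratify-superscripts φ
  stratify-superscripts (φ ⇒ ψ) (inj₁ p) =
    let k , k< , eq = stratify-superscripts φ p in k , <-≤-trans k< (m≤m⊔n _ _) , eq
  stratify-superscripts (φ ⇒ ψ) (inj₂ p) =
    let k , k< , eq = stratify-superscripts ψ p in k , <-≤-trans k< (m≤n⊔m _ _) , eq
  stratify-superscripts (all x φ) = stratify-superscripts φ
  stratify-superscripts (box j φ) p with j ≟ i | p
  ... | yes _ | inj₁ eq = depth φ , n<1+n _ , eq
  ... | yes _ | inj₂ q =
    let k , k< , eq = stratify-superscripts φ q in k , m<n⇒m<1+n k< , eq
  ... | no _ | q = ⊥-elim (embed-noSuperscripts φ _ q)

  stratify-stratified : ∀ φ → Stratified i (stratify φ)
  stratify-stratified (t ≐ u) = tt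
  stratify-stratified (neg φ) = stratify-stratified φ
  stratify-stratified (φ ⇒ ψ) = stratify-stratified φ , stratify-stratified ψ
  stratify-stratified (all x φ) = stratify-stratified φ
  stratify-stratified (box j φ) with j ≟ i
  ... | yes _ = refl , stratify-stratified φ , below
    where
    below : ∀ γ → γ ∈On stratify φ → γ <O ε₀-mult (depth φ)
    below γ p with stratify-superscripts φ p
    ... | k , k< , refl = ε₀-mult-mono k<
  ... | no j≢i = j≢i , embed-noSuperscripts φ

  stratify-veryStratified : ∀ φ → VeryStratified i (stratify φ)
  stratify-veryStratified φ = stratify-stratified φ , positive
    where
    positive : ∀ γ → γ ∈On stratify φ → IsPosMultOfε₀ γ
    positive γ p with stratify-superscripts φ p
    ... | k , _ , refl = ε₀-mult-isPosMultOfε₀ k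

lemma5p21 : (φ : FormulaPAω) → Sentence φ → Valid φ → (i : ℕ) →
            Σ FormulaPA𝓘 (λ ψ → Sentence ψ × VeryStratified i ψ × Valid ψ × (ψ ⁻) ≡ φ)
lemma5p21 φ closed valid i =
  stratify φ , stratify-sentence φ closed , stratify-veryStratified φ ,
  stratify-valid φ valid , stratify⁻ φ
  where open Stratification i
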